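{- Let $G$ be a (finite, simple, connected) graph of order $n\ge 9$ with twin number $\tau$, and let $W$ be a $\tau$-set. Then $\beta_p(G)=n-1$ if and only if either (i) $\tau=n-1$, or (ii) $\tau=n-2$ and $G[W]\cong K_{n-2}$.
   Context: Two vertices $u,v$ are twins if $N(u)\setminus\{v\}=N(v)\setminus\{u\}$. A twin set is a set of pairwise twin vertices; twin classes are the equivalence classes of the twin relation and $\tau(G)$ is the maximum cardinality of a twin class. A $\tau$-set is a twin set of cardinality $\tau(G)$. $G[W]$ is the subgraph induced by $W$. For $u$ a vertex and $S$ a vertex set, $d(u,S)=\min_{w\in S}d(u,w)$. A partition $\Pi=\{S_1,\dots,S_k\}$ of $V(G)$ is locating if the vectors $r(u|\Pi)=(d(u,S_1),\dots,d(u,S_k))$ are pairwise distinct over $u\in V(G)$; $\beta_p(G)$ is the minimum size of a locating partition. -}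

module Defs where

open import Data.Nat using (ℕ; zero; suc; _≤_)
open import Data.Fin using (Fin)
open import Data.Fin.Subset using (Subset; _∈_; ∣_∣)
open import Data.Product using (Σ; ∃; _×_; _,_)
open import Relation.Nullary using (¬_; Dec)
open import Relation.Binary.PropositionalEquality using (_≡_; _≢_)
open import Function.Bundles using (_⇔_)
open import Level using (0ℓ)

record Graph (n : ℕ) : Set₁ where
  field
    Adj     : Fin n → Fin n → Set
    adj?    : ∀ u v → Dec (Adj u v)
    sym     : ∀ {u v} → Adj u v → Adj v u
    irrefl  : ∀ {u} → ¬ Adj u u

module _ {n : ℕ} (G : Graph n) where
  open Graph G

  data Walk : Fin n → Fin n → ℕ → Set where
    here : ∀ {u} → Walk u u zero
    step : ∀ {u w v k} → Adj u w → Walk w v k → Walk u v (suc k)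

  Connected : Set
  Connected = ∀ u v → ∃ λ k → Walk u v k

  Dist : Fin n → Fin n → ℕ → Set
  Dist u v m = Walk u v m × (∀ k → Walk u v k → m ≤ k)

  Twin : Fin n → Fin n → Set
  Twin u v = ∀ w → w ≢ u → w ≢ v → (Adj u w ⇔ Adj v w)

  TwinSet : Subset n → Set
  TwinSet W = ∀ u v → u ∈ W → v ∈ W → Twin u v

  TwinClass : Subset n → Set
  TwinClass W = ∃ λ u → ∀ v → (v ∈ W ⇔ Twin u v)

  TwinNumber : ℕ → Set
  TwinNumber t = (∃ λ W → TwinClass W × ∣ W ∣ ≡ t)
               × (∀ W → TwinClass W → ∣ W ∣ ≤ t)

  TauSet : ℕ → Subset n → Set
  TauSet t W = TwinSet W × ∣ W ∣ ≡ t

  -- G[W] is complete (with |W| known, this is G[W] ≅ K_|W|)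
  CompleteOn : Subset n → Set
  CompleteOn W = ∀ u v → u ∈ W → v ∈ W → u ≢ v → Adj u v

  -- A partition into k (nonempty) classes: vertex u lies in class c u,
  -- every class is nonempty.
  Partition : ℕ → Set
  Partition k = Σ (Fin n → Fin k) λ c → ∀ i → ∃ λ w → c w ≡ i

  SetDist : ∀ {k} → (Fin n → Fin k) → Fin n → Fin k → ℕ → Set
  SetDist c u i m = (∃ λ w → c w ≡ i × Walk u w m)
                  × (∀ w j → c w ≡ i → Walk u w j → m ≤ j)

  Locating : ∀ {k} → Partition k → Set
  Locating (c , _) = ∀ u v → u ≢ v →
    ∃ λ i → ∃ λ a → ∃ λ b → SetDist c u i a × SetDist c v i b × a ≢ b

  PartitionDimension : ℕ → Set
  PartitionDimension m = (Σ (Partition m) Locating)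
                       × (∀ k (Π : Partition k) → Locating Π → m ≤ k)

-- The theorem then follows: β_p ≤ n - 1 always (merge a vertex outside
-- W with one of W); if W is a clique with n - 2 members, n - 2 classes cannot
-- locate; conversely, if no partition with n - 2 classes is locating, every
-- vertex has degree ≤ 1 or ≥ n - 2, and a case analysis on these degrees shows
-- τ ≥ n - 2 with W a clique when τ = n - 2.
module Submission where

open import Defs
open import Data.Nat using (ℕ; zero; suc; _≤_; _<_; _∸_; _+_; z≤n; s≤s)
import Data.Nat.Properties as ℕP
open import Data.Bool using (true)
open import Data.Fin using (Fin; zero; suc; punchOut; punchIn; _≟_)
open import Data.Fin.Properties
  using (any?; 0≢1+n; suc-injective; punchOut-injective; punchOut-cong; punchOut-punchIn; punchInᵢ≢i)
open import Data.Fin.Subset using (Subset; _∈_; _∉_; ∣_∣; ⊤; ⁅_⁆; _∪_; _⊆_; _⊂_; ∁; inside; outside; Nonempty)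
open import Data.Fin.Subset.Properties
  using (_∈?_; nonempty?; Empty-unique; ∣⊥∣≡0; p⊆q⇒∣p∣≤∣q∣; p⊂q⇒∣p∣<∣q∣; ∣⊤∣≡n; ∣⁅x⁆∣≡1; x∈⁅x⁆; x∈⁅y⁆⇒x≡y;
         x∈p∪q⁺; ∣∁p∣≡n∸∣p∣; x∈∁p⇒x∉p)
open import Data.Vec using ([]; _∷_; here; there; tabulate)
open import Data.Vec.Properties using (lookup∘tabulate; []=⇒lookup; lookup⇒[]=)
open import Data.Product using (Σ; ∃; ∃₂; _×_; _,_; proj₁; proj₂)
open import Data.Sum using (_⊎_; inj₁; inj₂)
open import Data.Empty using (⊥; ⊥-elim)
open import Relation.Nullary using (¬_; Dec; yes; no; does)
open import Relation.Nullary.Decidable using (_×-dec_; _⊎-dec_; ¬?; dec-true; decidable-stable)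
open import Relation.Binary.PropositionalEquality using (_≡_; _≢_; refl; sym; trans; cong; cong₂; subst)
open import Function using (_∘_; id)
open import Function.Bundles using (_⇔_; mk⇔; Equivalence)

∣empty∣≡0 : ∀ {n} (p : Subset n) → (∀ u → u ∉ p) → ∣ p ∣ ≡ 0
∣empty∣≡0 {n} p none = trans (cong ∣_∣ (Empty-unique λ { (u , u∈p) → none u u∈p })) (∣⊥∣≡0 n)

member : ∀ {n} (p : Subset n) → 0 < ∣ p ∣ → Nonempty p
member p pos with nonempty? p
... | yes inhabited = inhabited
... | no empty = ⊥-elim (ℕP.<⇒≢ pos (sym (∣empty∣≡0 p λ u u∈p → empty (u , u∈p))))

member⇒0<∣p∣ : ∀ {n} {v : Fin n} (p : Subset n) → v ∈ p → 0 < ∣ p ∣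
member⇒0<∣p∣ {v = v} p v∈p =
  subst (_≤ ∣ p ∣) (∣⁅x⁆∣≡1 v) (p⊆q⇒∣p∣≤∣q∣ λ x∈⁅v⁆ → subst (_∈ p) (sym (x∈⁅y⁆⇒x≡y v x∈⁅v⁆)) v∈p)

nonMember : ∀ {n} (p : Subset n) → ∣ p ∣ < n → ∃ λ v → v ∉ p
nonMember p small with member (∁ p) (subst (0 <_) (sym (∣∁p∣≡n∸∣p∣ p)) (ℕP.m<n⇒0<n∸m small))
... | v , v∈∁p = v , x∈∁p⇒x∉p v∈∁p

∣p∪q∣≤∣p∣+∣q∣ : ∀ {n} (p q : Subset n) → ∣ p ∪ q ∣ ≤ ∣ p ∣ + ∣ q ∣
∣p∪q∣≤∣p∣+∣q∣ [] [] = z≤n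
∣p∪q∣≤∣p∣+∣q∣ (outside ∷ p) (outside ∷ q) = ∣p∪q∣≤∣p∣+∣q∣ p q
∣p∪q∣≤∣p∣+∣q∣ (outside ∷ p) (inside ∷ q) =
  subst (suc ∣ p ∪ q ∣ ≤_) (sym (ℕP.+-suc ∣ p ∣ ∣ q ∣)) (s≤s (∣p∪q∣≤∣p∣+∣q∣ p q))
∣p∪q∣≤∣p∣+∣q∣ (inside ∷ p) (outside ∷ q) = s≤s (∣p∪q∣≤∣p∣+∣q∣ p q)
∣p∪q∣≤∣p∣+∣q∣ (inside ∷ p) (inside ∷ q) =
  s≤s (ℕP.≤-trans (∣p∪q∣≤∣p∣+∣q∣ p q) (ℕP.≤-trans (ℕP.n≤1+n _) (ℕP.≤-reflexive (sym (ℕP.+-suc ∣ p ∣ ∣ q ∣)))))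

pair : ∀ {n} → Fin n → Fin n → Subset n
pair a b = ⁅ a ⁆ ∪ ⁅ b ⁆

∣pair∣≤2 : ∀ {n} (a b : Fin n) → ∣ pair a b ∣ ≤ 2
∣pair∣≤2 a b = ℕP.≤-trans (∣p∪q∣≤∣p∣+∣q∣ ⁅ a ⁆ ⁅ b ⁆) (ℕP.≤-reflexive (cong₂ _+_ (∣⁅x⁆∣≡1 a) (∣⁅x⁆∣≡1 b)))

∈pair⁺ : ∀ {n} {x a b : Fin n} → x ≡ a ⊎ x ≡ b → x ∈ pair a b
∈pair⁺ {x = x} (inj₁ refl) = x∈p∪q⁺ (inj₁ (x∈⁅x⁆ x))
∈pair⁺ {x = x} (inj₂ refl) = x∈p∪q⁺ (inj₂ (x∈⁅x⁆ x))

cover : ∀ {n} (p q : Subset n) → (∀ v → v ∉ q → v ∈ p) → n ≤ ∣ p ∣ + ∣ q ∣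
cover {n} p q outside⊆p =
  ℕP.≤-trans (subst (_≤ ∣ p ∪ q ∣) (∣⊤∣≡n n) (p⊆q⇒∣p∣≤∣q∣ ⊤⊆p∪q)) (∣p∪q∣≤∣p∣+∣q∣ p q)
  where
  ⊤⊆p∪q : ⊤ ⊆ p ∪ q
  ⊤⊆p∪q {v} _ with v ∈? q
  ... | yes v∈q = x∈p∪q⁺ (inj₂ v∈q)
  ... | no v∉q = x∈p∪q⁺ (inj₁ (outside⊆p v v∉q))

allBut1 : ∀ {n} (p : Subset n) (a : Fin n) → (∀ v → v ≢ a → v ∈ p) → n ≤ ∣ p ∣ + 1
allBut1 {n} p a h = subst (n ≤_) (cong (∣ p ∣ +_) (∣⁅x⁆∣≡1 a))
  (cover p ⁅ a ⁆ λ v v∉⁅a⁆ → h v λ { refl → v∉⁅a⁆ (x∈⁅x⁆ v) })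

allBut2 : ∀ {n} (p : Subset n) (a b : Fin n) → (∀ v → v ≢ a → v ≢ b → v ∈ p) → n ≤ ∣ p ∣ + 2
allBut2 p a b h = ℕP.≤-trans (cover p (pair a b) outside⊆p) (ℕP.+-monoʳ-≤ ∣ p ∣ (∣pair∣≤2 a b))
  where
  outside⊆p : ∀ v → v ∉ pair a b → v ∈ p
  outside⊆p v v∉ = h v (λ v≡a → v∉ (∈pair⁺ (inj₁ v≡a))) (λ v≡b → v∉ (∈pair⁺ (inj₂ v≡b)))

within2 : ∀ {n} (p : Subset n) (a b : Fin n) → (∀ v → v ∈ p → v ≡ a ⊎ v ≡ b) → ∣ p ∣ ≤ 2
within2 p a b h = ℕP.≤-trans (p⊆q⇒∣p∣≤∣q∣ (λ {v} v∈p → ∈pair⁺ (h v v∈p))) (∣pair∣≤2 a b)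

avoid4 : ∀ {n} → 5 ≤ n → (a b c d : Fin n) → ∃ λ v → v ≢ a × v ≢ b × v ≢ c × v ≢ d
avoid4 5≤n a b c d with nonMember (pair a b ∪ pair c d) (ℕP.<-≤-trans (s≤s ∣four∣≤4) 5≤n)
  where
  ∣four∣≤4 : ∣ pair a b ∪ pair c d ∣ ≤ 4
  ∣four∣≤4 = ℕP.≤-trans (∣p∪q∣≤∣p∣+∣q∣ (pair a b) (pair c d)) (ℕP.+-mono-≤ (∣pair∣≤2 a b) (∣pair∣≤2 c d))
... | v , v∉ = v , (λ e → v∉ (x∈p∪q⁺ (inj₁ (∈pair⁺ (inj₁ e))))) , (λ e → v∉ (x∈p∪q⁺ (inj₁ (∈pair⁺ (inj₂ e)))))
                 , (λ e → v∉ (x∈p∪q⁺ (inj₂ (∈pair⁺ (inj₁ e))))) , (λ e → v∉ (x∈p∪q⁺ (inj₂ (∈pair⁺ (inj₂ e)))))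

InjectiveOn : ∀ {n k} → Subset n → (Fin n → Fin k) → Set
InjectiveOn p c = ∀ {u v} → u ∈ p → v ∈ p → c u ≡ c v → u ≡ v

-- The value j renumbered after deleting the value i (sending i itself anywhere).
skip : ∀ {k} (i j : Fin (suc (suc k))) → Fin (suc k)
skip i j with i ≟ j
... | yes _ = zero
... | no i≢j = punchOut i≢j

skip-injective : ∀ {k} {i j j′ : Fin (suc (suc k))} → i ≢ j → i ≢ j′ → skip i j ≡ skip i j′ → j ≡ j′
skip-injective {i = i} {j} {j′} i≢j i≢j′ eq with i ≟ j | i ≟ j′
... | yes i≡j | _ = ⊥-elim (i≢j i≡j)
... | no _ | yes i≡j′ = ⊥-elim (i≢j′ i≡j′)
... | no i≢j | no i≢j′ = punchOut-injective i≢j i≢j′ eq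

fin1-unique : (a b : Fin 1) → a ≡ b
fin1-unique zero zero = refl

mutual
  injectiveOn⇒∣p∣≤k : ∀ {n k} (p : Subset n) (c : Fin n → Fin k) → InjectiveOn p c → ∣ p ∣ ≤ k
  injectiveOn⇒∣p∣≤k [] c inj = z≤n
  injectiveOn⇒∣p∣≤k (outside ∷ p) c inj =
    injectiveOn⇒∣p∣≤k p (c ∘ suc) λ u∈p v∈p e → suc-injective (inj (there u∈p) (there v∈p) e)
  injectiveOn⇒∣p∣≤k (inside ∷ p) c inj =
    injectiveOn-avoiding⇒∣p∣<k p (c ∘ suc) (c zero)
      (λ u∈p e → 0≢1+n (inj here (there u∈p) (sym e)))
      (λ u∈p v∈p e → suc-injective (inj (there u∈p) (there v∈p) e))

  injectiveOn-avoiding⇒∣p∣<k : ∀ {n k} (p : Subset n) (c : Fin n → Fin k) (i : Fin k) →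
    (∀ {u} → u ∈ p → c u ≢ i) → InjectiveOn p c → ∣ p ∣ < k
  injectiveOn-avoiding⇒∣p∣<k {k = suc zero} p c i misses inj =
    s≤s (ℕP.≤-reflexive (∣empty∣≡0 p λ u u∈p → misses u∈p (fin1-unique (c u) i)))
  injectiveOn-avoiding⇒∣p∣<k {k = suc (suc k)} p c i misses inj =
    s≤s (injectiveOn⇒∣p∣≤k p (skip i ∘ c) λ u∈p v∈p e →
      inj u∈p v∈p (skip-injective (misses u∈p ∘ sym) (misses v∈p ∘ sym) e))

injectiveOn⇒onto : ∀ {n k} (p : Subset n) (c : Fin n → Fin k) → InjectiveOn p c → ∣ p ∣ ≡ k →
  ∀ i → ∃ λ w → w ∈ p × c w ≡ i
injectiveOn⇒onto p c inj ∣p∣≡k i with any? (λ w → (w ∈? p) ×-dec (c w ≟ i))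
... | yes hit = hit
... | no miss = ⊥-elim (ℕP.<⇒≢ (injectiveOn-avoiding⇒∣p∣<k p c i (λ {u} u∈p e → miss (u , u∈p , e)) inj) ∣p∣≡k)

twoOrAtMostOne : ∀ {n} (P : Fin n → Set) → (∀ x → Dec (P x)) →
  (∃₂ λ a b → a ≢ b × P a × P b) ⊎ (∀ a b → P a → P b → a ≡ b)
twoOrAtMostOne P P? with any? P?
... | no none = inj₂ λ a _ Pa _ → ⊥-elim (none (a , Pa))
... | yes (a , Pa) with any? (λ b → ¬? (b ≟ a) ×-dec P? b)
...   | yes (b , b≢a , Pb) = inj₁ (a , b , b≢a ∘ sym , Pa , Pb)
...   | no noOther = inj₂ λ x y Px Py → trans (onlyA x Px) (sym (onlyA y Py))
  where
  onlyA : ∀ x → P x → x ≡ a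
  onlyA x Px with x ≟ a
  ... | yes x≡a = x≡a
  ... | no x≢a = ⊥-elim (noOther (x , x≢a , Px))

-- Identifying two points p ≠ q of Fin (suc m): a surjection onto Fin m
-- whose only nontrivial fibre is {p, q}.
module Merge {m : ℕ} (p q : Fin (suc m)) (p≢q : p ≢ q) where

  representative : Fin (suc m) → Σ (Fin (suc m)) (q ≢_)
  representative x with x ≟ q
  ... | yes _ = p , p≢q ∘ sym
  ... | no x≢q = x , x≢q ∘ sym

  merge : Fin (suc m) → Fin m
  merge x = punchOut (proj₂ (representative x))

  representative-spec : ∀ x → (proj₁ (representative x) ≡ x × x ≢ q) ⊎ (x ≡ q × proj₁ (representative x) ≡ p)
  representative-spec x with x ≟ q
  ... | yes x≡q = inj₂ (x≡q , refl)
  ... | no x≢q = inj₁ (refl , x≢q)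

  merge-fibres : ∀ x y → merge x ≡ merge y → x ≡ y ⊎ (x ≡ p × y ≡ q) ⊎ (x ≡ q × y ≡ p)
  merge-fibres x y eq
    with punchOut-injective (proj₂ (representative x)) (proj₂ (representative y)) eq
       | representative-spec x | representative-spec y
  ... | e | inj₁ (rx , _) | inj₁ (ry , _) = inj₁ (trans (sym rx) (trans e ry))
  ... | e | inj₁ (rx , _) | inj₂ (y≡q , ry) = inj₂ (inj₁ (trans (sym rx) (trans e ry) , y≡q))
  ... | e | inj₂ (x≡q , rx) | inj₁ (ry , _) = inj₂ (inj₂ (x≡q , trans (sym ry) (trans (sym e) rx)))
  ... | _ | inj₂ (x≡q , _) | inj₂ (y≡q , _) = inj₁ (trans x≡q (sym y≡q))

  merge-onto : ∀ i → ∃ λ x → merge x ≡ i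
  merge-onto i with representative-spec (punchIn q i)
  ... | inj₁ (r , _) = punchIn q i , trans (punchOut-cong q r) (punchOut-punchIn q)
  ... | inj₂ (e , _) = ⊥-elim (punchInᵢ≢i q i e)

select : ∀ {n} {P : Fin n → Set} → (∀ x → Dec (P x)) → Subset n
select P? = tabulate (λ x → does (P? x))

∈select⁺ : ∀ {n} {P : Fin n → Set} (P? : ∀ x → Dec (P x)) {x} → P x → x ∈ select P?
∈select⁺ P? {x} Px = lookup⇒[]= x (select P?) (trans (lookup∘tabulate _ x) (dec-true (P? x) Px))

∈select⁻ : ∀ {n} {P : Fin n → Set} (P? : ∀ x → Dec (P x)) {x} → x ∈ select P? → P x
∈select⁻ P? {x} x∈ = fromTrue (P? x) (trans (sym (lookup∘tabulate _ x)) ([]=⇒lookup x∈))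
  where
  fromTrue : ∀ {A : Set} (d : Dec A) → does d ≡ true → A
  fromTrue (yes a) _ = a

leastWitness : (P : ℕ → Set) → (∀ m → Dec (P m)) → ∀ M → P M → ∃ λ m → P m × (∀ j → P j → m ≤ j)
leastWitness P P? M PM = search M 0 (ℕP.+-identityʳ M) (λ _ ())
  where
  -- Invariant: no j < k is a witness, and f more steps reach M.
  search : ∀ f k → f + k ≡ M → (∀ j → j < k → ¬ P j) → ∃ λ m → P m × (∀ j → P j → m ≤ j)
  search f k _ below with P? k
  ... | yes Pk = k , Pk , λ j Pj → ℕP.≮⇒≥ λ j<k → below j j<k Pj
  search zero k refl below | no ¬Pk = ⊥-elim (¬Pk PM)
  search (suc f) k eq below | no ¬Pk = search f (suc k) (trans (ℕP.+-suc f k) eq) below′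
    where
    below′ : ∀ j → j < suc k → ¬ P j
    below′ j j<1+k with ℕP.m<1+n⇒m<n∨m≡n j<1+k
    ... | inj₁ j<k = below j j<k
    ... | inj₂ refl = ¬Pk

module GraphFacts {n : ℕ} (G : Graph n) where
  open Graph G renaming (sym to adj-sym)

  adj⇒≢ : ∀ {a b} → Adj a b → a ≢ b
  adj⇒≢ a refl = irrefl a

  walk-length0 : ∀ {u v} → Walk G u v 0 → u ≡ v
  walk-length0 here = refl

  walk? : ∀ u v k → Dec (Walk G u v k)
  walk? u v zero with u ≟ v
  ... | yes refl = yes here
  ... | no u≢v = no (u≢v ∘ walk-length0)
  walk? u v (suc k) with any? (λ w → adj? u w ×-dec walk? w v k)
  ... | yes (w , a , walk) = yes (step a walk)
  ... | no none = no λ { (step a walk) → none (_ , a , walk) }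

  ReachesClass : ∀ {k} → (Fin n → Fin k) → Fin n → Fin k → ℕ → Set
  ReachesClass c u i m = ∃ λ w → c w ≡ i × Walk G u w m

  setDist : Connected G → ∀ {k} (c : Fin n → Fin k) u i → (∃ λ w → c w ≡ i) → ∃ λ m → SetDist G c u i m
  setDist conn c u i (w , cw≡i) with conn u w
  ... | M , walk with leastWitness (ReachesClass c u i) reaches? M (w , cw≡i , walk)
    where
    reaches? : ∀ m → Dec (ReachesClass c u i m)
    reaches? m = any? (λ w → (c w ≟ i) ×-dec walk? u w m)
  ... | m , reach , least = m , reach , λ w j cw≡i walk → least j (w , cw≡i , walk)

  setDist-≤ : ∀ {k} {c : Fin n → Fin k} {u i a w j} → SetDist G c u i a → c w ≡ i → Walk G u w j → a ≤ j
  setDist-≤ {w = w} {j = j} (_ , least) cw≡i walk = least w j cw≡i walk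

  setDist-positive : ∀ {k} {c : Fin n → Fin k} {u i a} → SetDist G c u i a → c u ≢ i → a ≢ 0
  setDist-positive {c = c} ((w , cw≡i , walk) , _) cu≢i refl =
    cu≢i (subst (λ x → c x ≡ _) (sym (walk-length0 walk)) cw≡i)

  setDist-neighbour : ∀ {k} {c : Fin n → Fin k} {u w i a} →
    SetDist G c u i a → c u ≢ i → c w ≡ i → Adj u w → a ≡ 1
  setDist-neighbour sd cu≢i cw≡i a with ℕP.n≤1⇒n≡0∨n≡1 (setDist-≤ sd cw≡i (step a here))
  ... | inj₁ a≡0 = ⊥-elim (setDist-positive sd cu≢i a≡0)
  ... | inj₂ a≡1 = a≡1

  Separates : Fin n → Fin n → Fin n → Set
  Separates z u v = (Adj u z × ¬ Adj v z) ⊎ (¬ Adj u z × Adj v z)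

  separates-sym : ∀ {z u v} → Separates z u v → Separates z v u
  separates-sym (inj₁ (uz , ¬vz)) = inj₂ (¬vz , uz)
  separates-sym (inj₂ (¬uz , vz)) = inj₁ (vz , ¬uz)

  Singleton : ∀ {k} → (Fin n → Fin k) → Fin n → Set
  Singleton c z = ∀ w → c w ≡ c z → w ≡ z

  singleton-neighbour : ∀ {k} {c : Fin n → Fin k} {u z} → Singleton c z → Adj u z → SetDist G c u (c z) 1
  singleton-neighbour {c = c} {u} {z} single uz = (z , refl , step uz here) , atLeast1
    where
    atLeast1 : ∀ w j → c w ≡ c z → Walk G u w j → 1 ≤ j
    atLeast1 w .0 cw≡cz here with single w cw≡cz
    ... | refl = ⊥-elim (irrefl uz)
    atLeast1 w _ _ (step _ _) = s≤s z≤n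

  singleton-nonNeighbour : ∀ {k} {c : Fin n → Fin k} {v z b} →
    Singleton c z → ¬ Adj v z → SetDist G c v (c z) b → b ≢ 1
  singleton-nonNeighbour {c = c} {v} {z} single ¬vz ((w , cw≡cz , walk) , _) refl = edge walk cw≡cz
    where
    edge : Walk G v w 1 → c w ≡ c z → ⊥
    edge (step vw here) cw≡cz with single _ cw≡cz
    ... | refl = ¬vz vw

  SeparatedBySingletons : ∀ {k} → (Fin n → Fin k) → Set
  SeparatedBySingletons c = ∀ u v → u ≢ v → c u ≡ c v → ∃ λ z → Singleton c z × Separates z u v

  -- This suffices: vertices in different classes differ at their own class (distance 0),
  -- and the separating singleton {z} is at distance 1 from exactly one of them.
  locating-criterion : Connected G → ∀ {k} (c : Fin n → Fin k) (onto : ∀ i → ∃ λ w → c w ≡ i) →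
    SeparatedBySingletons c → Locating G (c , onto)
  locating-criterion conn c onto separated u v u≢v with c u ≟ c v
  ... | no cu≢cv with setDist conn c v (c u) (u , refl)
  ...   | b , sb = c u , 0 , b , ((u , refl , here) , λ _ _ _ _ → z≤n) , sb ,
                   λ 0≡b → setDist-positive sb (cu≢cv ∘ sym) (sym 0≡b)
  locating-criterion conn c onto separated u v u≢v | yes cu≡cv with separated u v u≢v cu≡cv
  ... | z , single , inj₁ (uz , ¬vz) with setDist conn c v (c z) (z , refl)
  ...   | b , sb = c z , 1 , b , singleton-neighbour single uz , sb , singleton-nonNeighbour single ¬vz sb ∘ sym
  locating-criterion conn c onto separated u v u≢v | yes cu≡cv | z , single , inj₂ (¬uz , vz)
    with setDist conn c u (c z) (z , refl)
  ... | a , sa = c z , a , 1 , sa , singleton-neighbour single vz , singleton-nonNeighbour single ¬uz sa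

  commonNeighbours⇒sameDistances : ∀ {k} {c : Fin n → Fin k} {x y} → c x ≡ c y →
    (∀ i → c x ≢ i → ∃ λ w → c w ≡ i × Adj x w × Adj y w) →
    ∀ {i a b} → SetDist G c x i a → SetDist G c y i b → a ≡ b
  commonNeighbours⇒sameDistances {c = c} {x} cx≡cy common {i} sa sb with c x ≟ i
  ... | yes cx≡i = trans (ℕP.n≤0⇒n≡0 (setDist-≤ sa cx≡i here))
                         (sym (ℕP.n≤0⇒n≡0 (setDist-≤ sb (trans (sym cx≡cy) cx≡i) here)))
  ... | no cx≢i with common i cx≢i
  ...   | w , cw≡i , xw , yw = trans (setDist-neighbour sa cx≢i cw≡i xw)
                                     (sym (setDist-neighbour sb (cx≢i ∘ trans cx≡cy) cw≡i yw))

  twin-refl : ∀ u → Twin G u u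
  twin-refl u _ _ _ = mk⇔ id id

  twin-sym : ∀ {u v} → Twin G u v → Twin G v u
  twin-sym t w w≢v w≢u = mk⇔ (Equivalence.from (t w w≢u w≢v)) (Equivalence.to (t w w≢u w≢v))

  -- The twin relation is transitive; the only delicate neighbour is the middle vertex b itself,
  -- handled by passing through the symmetric edges a–c.
  twin-trans : ∀ {a b c} → Twin G a b → Twin G b c → Twin G a c
  twin-trans {a} {b} {c} tab tbc with a ≟ b | b ≟ c | a ≟ c
  ... | yes refl | _ | _ = tbc
  ... | no _ | yes refl | _ = tab
  ... | no _ | no _ | yes refl = twin-refl a
  ... | no a≢b | no b≢c | no a≢c = neighbours
    where
    neighbours : ∀ z → z ≢ a → z ≢ c → Adj a z ⇔ Adj c z
    neighbours z z≢a z≢c with z ≟ b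
    ... | no z≢b = mk⇔ (Equivalence.to (tbc z z≢b z≢c) ∘ Equivalence.to (tab z z≢a z≢b))
                       (Equivalence.from (tab z z≢a z≢b) ∘ Equivalence.from (tbc z z≢b z≢c))
    ... | yes refl = mk⇔
      (λ ab → adj-sym (Equivalence.to (tab c (a≢c ∘ sym) (b≢c ∘ sym)) (adj-sym (Equivalence.to (tbc a a≢b a≢c) (adj-sym ab)))))
      (λ cb → adj-sym (Equivalence.from (tbc a a≢b a≢c) (adj-sym (Equivalence.from (tab c (a≢c ∘ sym) (b≢c ∘ sym)) (adj-sym cb)))))

  Separable : Fin n → Fin n → Set
  Separable u v = ∃ λ z → z ≢ u × z ≢ v × Separates z u v

  twinOrSeparable : ∀ u v → Twin G u v ⊎ Separable u v
  twinOrSeparable u v with any? (λ z → ¬? (z ≟ u) ×-dec ¬? (z ≟ v) ×-dec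
                                       ((adj? u z ×-dec ¬? (adj? v z)) ⊎-dec (¬? (adj? u z) ×-dec adj? v z)))
  ... | yes separable = inj₂ separable
  ... | no inseparable = inj₁ λ w w≢u w≢v → mk⇔ (to w w≢u w≢v) (from w w≢u w≢v)
    where
    to : ∀ w → w ≢ u → w ≢ v → Adj u w → Adj v w
    to w w≢u w≢v uw with adj? v w
    ... | yes vw = vw
    ... | no ¬vw = ⊥-elim (inseparable (w , w≢u , w≢v , inj₁ (uw , ¬vw)))
    from : ∀ w → w ≢ u → w ≢ v → Adj v w → Adj u w
    from w w≢u w≢v vw with adj? u w
    ... | yes uw = uw
    ... | no ¬uw = ⊥-elim (inseparable (w , w≢u , w≢v , inj₂ (¬uw , vw)))

  twin? : ∀ u v → Dec (Twin G u v)
  twin? u v with twinOrSeparable u v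
  ... | inj₁ t = yes t
  ... | inj₂ (z , z≢u , z≢v , inj₁ (uz , ¬vz)) = no λ t → ¬vz (Equivalence.to (t z z≢u z≢v) uz)
  ... | inj₂ (z , z≢u , z≢v , inj₂ (¬uz , vz)) = no λ t → ¬uz (Equivalence.from (t z z≢u z≢v) vz)

  twinClass : Fin n → Subset n
  twinClass u = select (twin? u)

  twinClass-isClass : ∀ u → TwinClass G (twinClass u)
  twinClass-isClass u = u , λ v → mk⇔ (∈select⁻ (twin? u)) (∈select⁺ (twin? u))

  ∈twinClass : ∀ {u v} → Twin G u v → v ∈ twinClass u
  ∈twinClass = ∈select⁺ (twin? _)

  -- Twins in one class are at equal distance from every class; hence a locating
  -- partition separates twins, and a twin set has at most as many members as it has classes.
  twin-setDist-≤ : ∀ {k} {c : Fin n → Fin k} {u v i a b} → Twin G u v → c u ≡ c v →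
    SetDist G c u i a → SetDist G c v i b → b ≤ a
  twin-setDist-≤ t cu≡cv ((w , cw≡i , here) , _) sb = setDist-≤ sb (trans (sym cu≡cv) cw≡i) here
  twin-setDist-≤ {v = v} t cu≡cv ((w , cw≡i , step {w = x} ux rest) , _) sb with x ≟ v
  ... | yes refl = ℕP.m≤n⇒m≤1+n (setDist-≤ sb cw≡i rest)
  ... | no x≢v = setDist-≤ sb cw≡i (step (Equivalence.to (t x (adj⇒≢ ux ∘ sym) x≢v) ux) rest)

  locating⇒twinsSeparated : ∀ {k} {Π : Partition G k} → Locating G Π →
    ∀ {u v} → Twin G u v → u ≢ v → proj₁ Π u ≢ proj₁ Π v
  locating⇒twinsSeparated loc {u} {v} t u≢v cu≡cv with loc u v u≢v
  ... | i , a , b , sa , sb , a≢b =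
    a≢b (ℕP.≤-antisym (twin-setDist-≤ (twin-sym t) (sym cu≡cv) sb sa) (twin-setDist-≤ t cu≡cv sa sb))

  locating⇒injectiveOnTwinSet : ∀ {k} {Π : Partition G k} → Locating G Π →
    ∀ {W} → TwinSet G W → InjectiveOn W (proj₁ Π)
  locating⇒injectiveOnTwinSet {Π = Π} loc twins {u} {v} u∈W v∈W cu≡cv with u ≟ v
  ... | yes u≡v = u≡v
  ... | no u≢v = ⊥-elim (locating⇒twinsSeparated {Π = Π} loc (twins u v u∈W v∈W) u≢v cu≡cv)

  twinSet≤classes : ∀ {k} {Π : Partition G k} → Locating G Π → ∀ W → TwinSet G W → ∣ W ∣ ≤ k
  twinSet≤classes {Π = Π} loc W twins =
    injectiveOn⇒∣p∣≤k W (proj₁ Π) (locating⇒injectiveOnTwinSet {Π = Π} loc twins)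

  boundaryEdge : ∀ (W : Subset n) {a b k} → Walk G a b k → a ∈ W → b ∉ W → ∃₂ λ s t → s ∈ W × t ∉ W × Adj s t
  boundaryEdge W here a∈W a∉W = ⊥-elim (a∉W a∈W)
  boundaryEdge W {a} (step {w = x} ax rest) a∈W b∉W with x ∈? W
  ... | yes x∈W = boundaryEdge W rest x∈W b∉W
  ... | no x∉W = a , x , a∈W , x∉W , ax

  walk-preserves : (P : Fin n → Set) → (∀ {x y} → P x → Adj x y → P y) → ∀ {a b k} → Walk G a b k → P a → P b
  walk-preserves P step-preserves here Pa = Pa
  walk-preserves P step-preserves (step ax rest) Pa = walk-preserves P step-preserves rest (step-preserves Pa ax)

  twinSet-outsideNeighbour : Connected G → ∀ W → TwinSet G W → ∀ {w₀ y} → w₀ ∈ W → y ∉ W →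
    ∃ λ x → x ∉ W × ∀ w → w ∈ W → Adj x w
  twinSet-outsideNeighbour conn W twins {w₀} {y} w₀∈W y∉W with boundaryEdge W (proj₂ (conn w₀ y)) w₀∈W y∉W
  ... | s , x , s∈W , x∉W , sx = x , x∉W , adjacentToAll
    where
    adjacentToAll : ∀ w → w ∈ W → Adj x w
    adjacentToAll w w∈W with w ≟ s
    ... | yes refl = adj-sym sx
    ... | no _ = adj-sym (Equivalence.to (twins s w s∈W w∈W x (λ { refl → x∉W s∈W }) (λ { refl → x∉W w∈W })) sx)

  -- Vertices of degree at most 1, and vertices missing at most one other vertex.
  Low : Fin n → Set
  Low z = ∀ a b → Adj z a → Adj z b → a ≡ b

  High : Fin n → Set
  High z = ∀ a b → a ≢ z → b ≢ z → ¬ Adj z a → ¬ Adj z b → a ≡ b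

  TwoNeighbours : Fin n → Set
  TwoNeighbours z = ∃₂ λ a b → a ≢ b × Adj z a × Adj z b

  TwoNonNeighbours : Fin n → Set
  TwoNonNeighbours z = ∃₂ λ a b → a ≢ b × (a ≢ z × ¬ Adj z a) × (b ≢ z × ¬ Adj z b)

  twoNeighboursOrLow : ∀ z → TwoNeighbours z ⊎ Low z
  twoNeighboursOrLow z = twoOrAtMostOne (Adj z) (adj? z)

  twoNonNeighboursOrHigh : ∀ z → TwoNonNeighbours z ⊎ High z
  twoNonNeighboursOrHigh z with twoOrAtMostOne (λ a → a ≢ z × ¬ Adj z a) (λ a → ¬? (a ≟ z) ×-dec ¬? (adj? z a))
  ... | inj₁ two = inj₁ two
  ... | inj₂ atMostOne = inj₂ λ a b a≢z b≢z ¬za ¬zb → atMostOne a b (a≢z , ¬za) (b≢z , ¬zb)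

  low⇒¬twoNeighbours : ∀ {z} → Low z → ¬ TwoNeighbours z
  low⇒¬twoNeighbours low (a , b , a≢b , za , zb) = a≢b (low a b za zb)

  low? : ∀ z → Dec (Low z)
  low? z with twoNeighboursOrLow z
  ... | inj₁ two = no λ low → low⇒¬twoNeighbours low two
  ... | inj₂ low = yes low

  twoNeighbours? : ∀ z → Dec (TwoNeighbours z)
  twoNeighbours? z with twoNeighboursOrLow z
  ... | inj₁ two = yes two
  ... | inj₂ low = no (low⇒¬twoNeighbours low)

  high-adjacent : ∀ {x} → High x → ∀ {y z} → y ≢ x → z ≢ x → ¬ Adj x y → y ≢ z → Adj x z
  high-adjacent {x} high {y} {z} y≢x z≢x ¬xy y≢z with adj? x z
  ... | yes xz = xz
  ... | no ¬xz = ⊥-elim (y≢z (high y z y≢x z≢x ¬xy ¬xz))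

mergeSeparable : ∀ {n′} (G : Graph (suc n′)) → Connected G → ∀ {x y} → x ≢ y →
  GraphFacts.Separable G x y → Σ (Partition G n′) (Locating G)
mergeSeparable G conn {x} {y} x≢y (z , z≢x , z≢y , separates) =
  (merge , merge-onto) , locating-criterion conn merge merge-onto separated
  where
  open GraphFacts G
  open Merge x y x≢y
  single : Singleton merge z
  single w e with merge-fibres w z e
  ... | inj₁ w≡z = w≡z
  ... | inj₂ (inj₁ (_ , z≡y)) = ⊥-elim (z≢y z≡y)
  ... | inj₂ (inj₂ (_ , z≡x)) = ⊥-elim (z≢x z≡x)
  separated : SeparatedBySingletons merge
  separated u v u≢v e with merge-fibres u v e
  ... | inj₁ u≡v = ⊥-elim (u≢v u≡v)
  ... | inj₂ (inj₁ (refl , refl)) = z , single , separates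
  ... | inj₂ (inj₂ (refl , refl)) = z , single , separates-sym separates

module DoubleMerge {m : ℕ} (G : Graph (suc (suc m))) (conn : Connected G)
                   (p q : Fin (suc (suc m))) (p≢q : p ≢ q) (p₂ q₂ : Fin (suc (suc m)))
                   (images≢ : Merge.merge p q p≢q p₂ ≢ Merge.merge p q p≢q q₂) where
  open GraphFacts G
  open Merge p q p≢q
  module Second = Merge (merge p₂) (merge q₂) images≢

  collapse : Fin (suc (suc m)) → Fin m
  collapse x = Second.merge (merge x)

  collapse-onto : ∀ i → ∃ λ x → collapse x ≡ i
  collapse-onto i with Second.merge-onto i
  ... | y , e with merge-onto y
  ...   | x , refl = x , e

  collapse-fibres : ∀ x y → collapse x ≡ collapse y →
    merge x ≡ merge y ⊎ (merge x ≡ merge p₂ × merge y ≡ merge q₂) ⊎ (merge x ≡ merge q₂ × merge y ≡ merge p₂)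
  collapse-fibres x y = Second.merge-fibres (merge x) (merge y)

  merge-injective : ∀ x y → merge x ≡ merge y → y ≢ p → y ≢ q → x ≡ y
  merge-injective x y e y≢p y≢q with merge-fibres x y e
  ... | inj₁ x≡y = x≡y
  ... | inj₂ (inj₁ (_ , y≡q)) = ⊥-elim (y≢q y≡q)
  ... | inj₂ (inj₂ (_ , y≡p)) = ⊥-elim (y≢p y≡p)

  collapse-singleton : ∀ {z} → z ≢ p → z ≢ q → z ≢ p₂ → z ≢ q₂ → Singleton collapse z
  collapse-singleton {z} z≢p z≢q z≢p₂ z≢q₂ w e with collapse-fibres w z e
  ... | inj₁ e₁ = merge-injective w z e₁ z≢p z≢q
  ... | inj₂ (inj₁ (_ , e₂)) = ⊥-elim (z≢q₂ (sym (merge-injective q₂ z (sym e₂) z≢p z≢q)))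
  ... | inj₂ (inj₂ (_ , e₂)) = ⊥-elim (z≢p₂ (sym (merge-injective p₂ z (sym e₂) z≢p z≢q)))

  locating : SeparatedBySingletons collapse → Σ (Partition G m) (Locating G)
  locating separated = (collapse , collapse-onto) , locating-criterion conn collapse collapse-onto separated

module _ {m : ℕ} (G : Graph (suc (suc m))) (conn : Connected G) where
  open GraphFacts G

  mergeTwoPairs : ∀ {a b c d z} → a ≢ b → c ≢ d → a ≢ c → a ≢ d → b ≢ c → b ≢ d →
    z ≢ a → z ≢ b → z ≢ c → z ≢ d → Separates z a b → Separates z c d → Σ (Partition G m) (Locating G)
  mergeTwoPairs {a} {b} {c} {d} {z} a≢b c≢d a≢c a≢d b≢c b≢d z≢a z≢b z≢c z≢d zab zcd = locating separated
    where
    images≢ : Merge.merge a b a≢b c ≢ Merge.merge a b a≢b d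
    images≢ e with Merge.merge-fibres a b a≢b c d e
    ... | inj₁ c≡d = c≢d c≡d
    ... | inj₂ (inj₁ (c≡a , _)) = a≢c (sym c≡a)
    ... | inj₂ (inj₂ (c≡b , _)) = b≢c (sym c≡b)
    open DoubleMerge G conn a b a≢b c d images≢
    single : Singleton collapse z
    single = collapse-singleton z≢a z≢b z≢c z≢d
    separated : SeparatedBySingletons collapse
    separated u v u≢v e with collapse-fibres u v e
    ... | inj₁ e₁ with Merge.merge-fibres a b a≢b u v e₁
    ...   | inj₁ u≡v = ⊥-elim (u≢v u≡v)
    ...   | inj₂ (inj₁ (refl , refl)) = z , single , zab
    ...   | inj₂ (inj₂ (refl , refl)) = z , single , separates-sym zab
    separated u v u≢v e | inj₂ (inj₁ (e₁ , e₂))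
      with merge-injective u c e₁ (a≢c ∘ sym) (b≢c ∘ sym) | merge-injective v d e₂ (a≢d ∘ sym) (b≢d ∘ sym)
    ... | refl | refl = z , single , zcd
    separated u v u≢v e | inj₂ (inj₂ (e₁ , e₂))
      with merge-injective u d e₁ (a≢d ∘ sym) (b≢d ∘ sym) | merge-injective v c e₂ (a≢c ∘ sym) (b≢c ∘ sym)
    ... | refl | refl = z , single , separates-sym zcd

  mergeTriple : ∀ {a c x b d} → a ≢ c → a ≢ x → c ≢ x →
    b ≢ a → b ≢ c → b ≢ x → d ≢ a → d ≢ c → d ≢ x →
    Separates b a c → Separates b a x → Separates d c x → Σ (Partition G m) (Locating G)
  mergeTriple {a} {c} {x} {b} {d} a≢c a≢x c≢x b≢a b≢c b≢x d≢a d≢c d≢x bac bax dcx = locating separated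
    where
    images≢ : Merge.merge a c a≢c a ≢ Merge.merge a c a≢c x
    images≢ e with Merge.merge-fibres a c a≢c a x e
    ... | inj₁ a≡x = a≢x a≡x
    ... | inj₂ (inj₁ (_ , x≡c)) = c≢x (sym x≡c)
    ... | inj₂ (inj₂ (a≡c , _)) = a≢c a≡c
    open DoubleMerge G conn a c a≢c a x images≢
    single-b : Singleton collapse b
    single-b = collapse-singleton b≢a b≢c b≢a b≢x
    single-d : Singleton collapse d
    single-d = collapse-singleton d≢a d≢c d≢a d≢x
    -- A partner of x in the merged class is a or c.
    partnerOfX : ∀ u → Merge.merge a c a≢c u ≡ Merge.merge a c a≢c a → ∃ λ z → Singleton collapse z × Separates z u x
    partnerOfX u e with Merge.merge-fibres a c a≢c u a e
    ... | inj₁ refl = b , single-b , bax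
    ... | inj₂ (inj₁ (refl , _)) = b , single-b , bax
    ... | inj₂ (inj₂ (refl , _)) = d , single-d , dcx
    separated : SeparatedBySingletons collapse
    separated u v u≢v e with collapse-fibres u v e
    ... | inj₁ e₁ with Merge.merge-fibres a c a≢c u v e₁
    ...   | inj₁ u≡v = ⊥-elim (u≢v u≡v)
    ...   | inj₂ (inj₁ (refl , refl)) = b , single-b , bac
    ...   | inj₂ (inj₂ (refl , refl)) = b , single-b , separates-sym bac
    separated u v u≢v e | inj₂ (inj₁ (e₁ , e₂)) with merge-injective v x e₂ (a≢x ∘ sym) (c≢x ∘ sym)
    ... | refl = partnerOfX u e₁
    separated u v u≢v e | inj₂ (inj₂ (e₁ , e₂)) with merge-injective u x e₁ (a≢x ∘ sym) (c≢x ∘ sym)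
    ... | refl with partnerOfX v e₂
    ...   | z , single , zvx = z , single , separates-sym zvx

-- The theorem for graphs on n = m + 2 ≥ 5 vertices; note n ∸ 1 = suc m and n ∸ 2 = m.
module AtLeastFiveVertices {m : ℕ} (3≤m : 3 ≤ m) (G : Graph (suc (suc m))) (conn : Connected G)
                           (τ : ℕ) (twinNumber : TwinNumber G τ) (W : Subset (suc (suc m))) (tauSet : TauSet G τ W) where
  open Graph G renaming (sym to adj-sym)
  open GraphFacts G

  W-twins : TwinSet G W
  W-twins = proj₁ tauSet

  ∣W∣≡τ : ∣ W ∣ ≡ τ
  ∣W∣≡τ = proj₂ tauSet

  twinClass≤τ : ∀ u → ∣ twinClass u ∣ ≤ τ
  twinClass≤τ u = proj₂ twinNumber (twinClass u) (twinClass-isClass u)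

  avoid : (a b c d : Fin (suc (suc m))) → ∃ λ v → v ≢ a × v ≢ b × v ≢ c × v ≢ d
  avoid = avoid4 (s≤s (s≤s 3≤m))

  -- Every vertex has a neighbour, G being connected with more than one vertex.
  neighbour : ∀ z → ∃ λ w → Adj z w
  neighbour z with avoid z z z z
  ... | v , v≢z , _ with conn z v
  ...   | _ , here = ⊥-elim (v≢z refl)
  ...   | _ , step {w = w} zw _ = w , zw

  W-member : ∃ λ w → w ∈ W
  W-member = member W (subst (0 <_) (sym ∣W∣≡τ)
    (ℕP.<-≤-trans (member⇒0<∣p∣ (twinClass zero) (∈twinClass (twin-refl zero))) (twinClass≤τ zero)))

  W-nonMember : τ < suc (suc m) → ∃ λ y → y ∉ W
  W-nonMember τ<n = nonMember W (subst (_< suc (suc m)) (sym ∣W∣≡τ) τ<n)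

  -- Lower bound: twins lie in distinct classes of a locating partition, so it has at least τ classes.
  τ≤classes : ∀ {k} (Π : Partition G k) → Locating G Π → τ ≤ k
  τ≤classes Π loc = subst (_≤ _) ∣W∣≡τ (twinSet≤classes {Π = Π} loc W W-twins)

  -- Upper bound: a vertex y ∉ W is no twin of w ∈ W (W ∪ {y} would lie in one twin class
  -- larger than τ), so some vertex separates them and merging y with w is locating.
  partition-n-1 : τ ≤ suc m → Σ (Partition G (suc m)) (Locating G)
  partition-n-1 τ≤n-1 with W-nonMember (s≤s τ≤n-1) | W-member
  ... | y , y∉W | w , w∈W with twinOrSeparable y w
  ... | inj₂ separable = mergeSeparable G conn (λ { refl → y∉W w∈W }) separable
  ... | inj₁ twin = ⊥-elim (ℕP.<-irrefl refl (ℕP.<-≤-trans (subst (_< ∣ twinClass y ∣) ∣W∣≡τ (p⊂q⇒∣p∣<∣q∣ W⊂class))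
                                                         (twinClass≤τ y)))
    where
    W⊂class : W ⊂ twinClass y
    W⊂class = (λ {v} v∈W → ∈twinClass (twin-trans twin (W-twins w v w∈W v∈W))) , y , ∈twinClass (twin-refl y) , y∉W

  -- If W is a clique of n - 2 vertices, no locating partition has n - 2 classes: W would
  -- meet every class exactly once, and a vertex x ∉ W adjacent to all of W would share
  -- its distance vector with the member of W in its own class.
  clique⇒noPartition-n-2 : CompleteOn G W → τ ≡ m → Σ (Partition G m) (Locating G) → ⊥
  clique⇒noPartition-n-2 clique τ≡m ((c , onto) , loc) with W-member | W-nonMember (subst (_< _) (sym τ≡m) (ℕP.m<n⇒m<1+n (ℕP.n<1+n m)))
  ... | w₀ , w₀∈W | y , y∉W with twinSet-outsideNeighbour conn W W-twins w₀∈W y∉W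
  ... | x , x∉W , x-adj = fail (loc x wₓ λ x≡wₓ → x∉W (subst (_∈ W) (sym x≡wₓ) wₓ∈W))
    where
    representative : ∀ i → ∃ λ w → w ∈ W × c w ≡ i
    representative = injectiveOn⇒onto W c (locating⇒injectiveOnTwinSet {Π = c , onto} loc W-twins) (trans ∣W∣≡τ τ≡m)
    wₓ = proj₁ (representative (c x))
    wₓ∈W = proj₁ (proj₂ (representative (c x)))
    cwₓ≡cx = proj₂ (proj₂ (representative (c x)))
    common : ∀ i → c x ≢ i → ∃ λ w → c w ≡ i × Adj x w × Adj wₓ w
    common i cx≢i with representative i
    ... | w , w∈W , cw≡i = w , cw≡i , x-adj w w∈W ,
          clique wₓ w wₓ∈W w∈W λ { refl → cx≢i (trans (sym cwₓ≡cx) cw≡i) }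
    fail : ¬ ∃ λ i → ∃ λ a → ∃ λ b → SetDist G c x i a × SetDist G c wₓ i b × a ≢ b
    fail (i , a , b , sa , sb , a≢b) =
      a≢b (commonNeighbours⇒sameDistances (sym cwₓ≡cx) common sa sb)

  module Forward (minimal : ∀ k (Π : Partition G k) → Locating G Π → suc m ≤ k) (τ≤m : τ ≤ m) where

    noPartition-n-2 : ¬ Σ (Partition G m) (Locating G)
    noPartition-n-2 (Π , loc) = ℕP.n≮n m (minimal m Π loc)

    noTwinClass-n-1 : ∀ u → suc (suc m) ≤ ∣ twinClass u ∣ + 1 → ⊥
    noTwinClass-n-1 u big = ℕP.n≮n (suc m)
      (ℕP.≤-trans big (ℕP.≤-trans (ℕP.+-monoˡ-≤ 1 (ℕP.≤-trans (twinClass≤τ u) τ≤m)) (ℕP.≤-reflexive (ℕP.+-comm m 1))))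

    twinClass-n-2⇒τ≡m : ∀ u → suc (suc m) ≤ ∣ twinClass u ∣ + 2 → τ ≡ m
    twinClass-n-2⇒τ≡m u big = ℕP.≤-antisym τ≤m (ℕP.≤-pred (ℕP.≤-pred
      (ℕP.≤-trans big (ℕP.≤-trans (ℕP.+-monoˡ-≤ 2 (twinClass≤τ u)) (ℕP.≤-reflexive (ℕP.+-comm τ 2))))))

    clique : (∀ {s t} → s ∈ W → t ∈ W → s ≢ t → ¬ Adj s t → ⊥) → CompleteOn G W
    clique noMissingEdge u v u∈W v∈W u≢v = decidable-stable (adj? u v) (noMissingEdge u∈W v∈W u≢v)

    -- Every vertex is Low or High: two neighbours a, c and two non-neighbours b, d of z
    -- could be merged into the pairs {a, b}, {c, d}, both separated by z.
    lowOrHigh : ∀ z → Low z ⊎ High z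
    lowOrHigh z with twoNeighboursOrLow z | twoNonNeighboursOrHigh z
    ... | inj₂ low | _ = inj₁ low
    ... | inj₁ _ | inj₂ high = inj₂ high
    ... | inj₁ (a , c , a≢c , za , zc) | inj₁ (b , d , b≢d , (b≢z , ¬zb) , (d≢z , ¬zd)) =
      ⊥-elim (noPartition-n-2 (mergeTwoPairs G conn
        (λ { refl → ¬zb za }) (λ { refl → ¬zd zc }) a≢c (λ { refl → ¬zd za }) (λ { refl → ¬zb zc }) b≢d
        (adj⇒≢ za) (b≢z ∘ sym) (adj⇒≢ zc) (d≢z ∘ sym)
        (inj₁ (adj-sym za , ¬zb ∘ adj-sym)) (inj₁ (adj-sym zc , ¬zd ∘ adj-sym))))

    twoNeighbours⇒high : ∀ {z} → TwoNeighbours z → High z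
    twoNeighbours⇒high {z} two with lowOrHigh z
    ... | inj₁ low = ⊥-elim (low⇒¬twoNeighbours low two)
    ... | inj₂ high = high

    module LowVertex (ℓ h : Fin (suc (suc m))) (ℓ-low : Low ℓ) (ℓh : Adj ℓ h) where

      h≢ℓ : h ≢ ℓ
      h≢ℓ = adj⇒≢ ℓh ∘ sym

      notAdjℓ : ∀ {r} → r ≢ h → ¬ Adj r ℓ
      notAdjℓ {r} r≢h rℓ = r≢h (ℓ-low r h (adj-sym rℓ) ℓh)

      -- Case 1a: some u ∉ {ℓ, h} has two neighbours. Then all vertices outside {ℓ, h} are
      -- High, hence adjacent to everything but ℓ: they form a twin class of size n - 2,
      -- and one checks that W has no missing edge.
      module SomeVertexOfDegree2 (u : Fin (suc (suc m))) (u≢ℓ : u ≢ ℓ) (u≢h : u ≢ h) (u-two : TwoNeighbours u) where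

        u-high : High u
        u-high = twoNeighbours⇒high u-two

        u-adj : ∀ {y} → y ≢ u → y ≢ ℓ → Adj u y
        u-adj y≢u y≢ℓ = high-adjacent u-high (u≢ℓ ∘ sym) y≢u (notAdjℓ u≢h) (y≢ℓ ∘ sym)

        noOtherLow : ∀ {v} → v ≢ ℓ → v ≢ h → v ≢ u → ¬ Low v
        noOtherLow {v} v≢ℓ v≢h v≢u v-low with avoid ℓ h u v
        ... | w , w≢ℓ , w≢h , w≢u , w≢v with lowOrHigh w
        ...   | inj₂ w-high = w≢u (sym (v-low u w (adj-sym uv)
                                 (adj-sym (high-adjacent w-high (w≢ℓ ∘ sym) v≢w (notAdjℓ w≢h) (v≢ℓ ∘ sym)))))
          where
          uv = u-adj v≢u v≢ℓ
          v≢w : v ≢ w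
          v≢w v≡w = w≢v (sym v≡w)
        ...   | inj₁ w-low = u≢h (sym (w-low h u (adj-sym hw) (adj-sym (u-adj w≢u w≢ℓ))))
          where
          ¬vh : ¬ Adj v h
          ¬vh vh = u≢h (v-low u h (adj-sym (u-adj v≢u v≢ℓ)) vh)
          h-high : High h
          h-high with lowOrHigh h
          ... | inj₁ h-low = ⊥-elim (u≢ℓ (sym (h-low ℓ u (adj-sym ℓh) (adj-sym (u-adj (u≢h ∘ sym) h≢ℓ)))))
          ... | inj₂ high = high
          hw : Adj h w
          hw = high-adjacent h-high v≢h w≢h (¬vh ∘ adj-sym) (w≢v ∘ sym)

        outside-high : ∀ {r} → r ≢ ℓ → r ≢ h → High r
        outside-high {r} r≢ℓ r≢h with lowOrHigh r
        ... | inj₂ high = high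
        ... | inj₁ low with r ≟ u
        ...   | yes refl = ⊥-elim (low⇒¬twoNeighbours low u-two)
        ...   | no r≢u = ⊥-elim (noOtherLow r≢ℓ r≢h r≢u low)

        outside-adj : ∀ {r y} → r ≢ ℓ → r ≢ h → y ≢ r → y ≢ ℓ → Adj r y
        outside-adj r≢ℓ r≢h y≢r y≢ℓ = high-adjacent (outside-high r≢ℓ r≢h) (r≢ℓ ∘ sym) y≢r (notAdjℓ r≢h) (y≢ℓ ∘ sym)

        outside-twins : ∀ {r r′} → r ≢ ℓ → r ≢ h → r′ ≢ ℓ → r′ ≢ h → Twin G r r′
        outside-twins {r} {r′} r≢ℓ r≢h r′≢ℓ r′≢h z z≢r z≢r′ with z ≟ ℓ
        ... | yes refl = mk⇔ (⊥-elim ∘ notAdjℓ r≢h) (⊥-elim ∘ notAdjℓ r′≢h)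
        ... | no z≢ℓ = mk⇔ (λ _ → outside-adj r′≢ℓ r′≢h z≢r′ z≢ℓ) (λ _ → outside-adj r≢ℓ r≢h z≢r z≢ℓ)

        h-adj : ∀ {y} → y ≢ h → Adj h y
        h-adj {y} y≢h with y ≟ ℓ
        ... | yes refl = adj-sym ℓh
        ... | no y≢ℓ = adj-sym (outside-adj y≢ℓ y≢h (y≢h ∘ sym) h≢ℓ)

        -- A twin t of ℓ is adjacent to ℓ: otherwise a vertex r′ ∉ {ℓ, h, t}, adjacent to t,
        -- would be a second neighbour of ℓ.
        twinOfℓ-adj : ∀ {t} → t ≢ ℓ → Twin G ℓ t → Adj ℓ t
        twinOfℓ-adj {t} t≢ℓ twin with adj? ℓ t
        ... | yes ℓt = ℓt
        ... | no ¬ℓt with avoid ℓ h t t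
        ...   | r′ , r′≢ℓ , r′≢h , r′≢t , _ =
          ⊥-elim (r′≢h (ℓ-low r′ h (Equivalence.from (twin r′ r′≢ℓ r′≢t) (outside-adj t≢ℓ t≢h r′≢t r′≢ℓ)) ℓh))
          where
          t≢h : t ≢ h
          t≢h refl = ¬ℓt ℓh

        noMissingEdge : ∀ {s t} → s ∈ W → t ∈ W → s ≢ t → ¬ Adj s t → ⊥
        noMissingEdge {s} {t} s∈W t∈W s≢t ¬st with s ≟ ℓ | s ≟ h | t ≟ ℓ | t ≟ h
        ... | yes refl | _ | _ | _ = ¬st (twinOfℓ-adj (s≢t ∘ sym) (W-twins s t s∈W t∈W))
        ... | no _ | yes refl | _ | _ = ¬st (h-adj (s≢t ∘ sym))
        ... | no s≢ℓ | no _ | yes refl | _ = ¬st (adj-sym (twinOfℓ-adj s≢ℓ (W-twins t s t∈W s∈W)))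
        ... | no _ | no s≢h | no _ | yes refl = ¬st (adj-sym (h-adj s≢h))
        ... | no s≢ℓ | no s≢h | no t≢ℓ | no _ = ¬st (outside-adj s≢ℓ s≢h (s≢t ∘ sym) t≢ℓ)

        result : τ ≡ m × CompleteOn G W
        result = twinClass-n-2⇒τ≡m u (allBut2 (twinClass u) ℓ h λ v v≢ℓ v≢h → ∈twinClass (outside-twins u≢ℓ u≢h v≢ℓ v≢h))
               , clique noMissingEdge

      -- Case 1b: every vertex outside {ℓ, h} is Low. If h is Low too, {ℓ, h} is a
      -- connected component; if h is High, all vertices but h are twins of ℓ.
      module OthersLow (others-low : ∀ {r} → r ≢ ℓ → r ≢ h → Low r) where

        h-notLow : ¬ Low h
        h-notLow h-low with avoid ℓ h ℓ h
        ... | r , r≢ℓ , r≢h , _ with walk-preserves InEdge closed (proj₂ (conn ℓ r)) (inj₁ refl)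
          where
          InEdge : Fin (suc (suc m)) → Set
          InEdge x = x ≡ ℓ ⊎ x ≡ h
          closed : ∀ {x y} → InEdge x → Adj x y → InEdge y
          closed (inj₁ refl) xy = inj₂ (ℓ-low _ h xy ℓh)
          closed (inj₂ refl) xy = inj₁ (h-low _ ℓ xy (adj-sym ℓh))
        ...   | inj₁ r≡ℓ = r≢ℓ r≡ℓ
        ...   | inj₂ r≡h = r≢h r≡h

        -- If h is High, it is adjacent to every r ∉ {ℓ, h}: the neighbour s of r is not h,
        -- and r, s would be two distinct non-neighbours of h.
        adj-h : High h → ∀ {r} → r ≢ ℓ → r ≢ h → Adj r h
        adj-h h-high {r} r≢ℓ r≢h with adj? r h | neighbour r
        ... | yes rh | _ = rh
        ... | no ¬rh | s , rs = ⊥-elim (adj⇒≢ rs (h-high r s r≢h s≢h (¬rh ∘ adj-sym) (¬sh ∘ adj-sym)))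
          where
          s≢h : s ≢ h
          s≢h refl = ¬rh rs
          s≢ℓ : s ≢ ℓ
          s≢ℓ refl = notAdjℓ r≢h rs
          ¬sh : ¬ Adj s h
          ¬sh sh = r≢h (others-low s≢ℓ s≢h r h (adj-sym rs) sh)

        result : ⊥
        result with lowOrHigh h
        ... | inj₁ h-low = h-notLow h-low
        ... | inj₂ h-high = noTwinClass-n-1 ℓ (allBut1 (twinClass ℓ) h λ v v≢h → ∈twinClass (twinOfℓ v v≢h))
          where
          twinOfℓ : ∀ v → v ≢ h → Twin G ℓ v
          twinOfℓ v v≢h with v ≟ ℓ
          ... | yes refl = twin-refl v
          ... | no v≢ℓ = λ z _ _ → mk⇔
            (λ ℓz → subst (Adj v) (sym (ℓ-low z h ℓz ℓh)) (adj-h h-high v≢ℓ v≢h))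
            (λ vz → subst (Adj ℓ) (sym (others-low v≢ℓ v≢h z h vz (adj-h h-high v≢ℓ v≢h))) ℓh)

      result : τ ≡ m × CompleteOn G W
      result with any? (λ u → ¬? (u ≟ ℓ) ×-dec ¬? (u ≟ h) ×-dec twoNeighbours? u)
      ... | yes (u , u≢ℓ , u≢h , u-two) = SomeVertexOfDegree2.result u u≢ℓ u≢h u-two
      ... | no none = ⊥-elim (OthersLow.result others-low)
        where
        others-low : ∀ {r} → r ≢ ℓ → r ≢ h → Low r
        others-low {r} r≢ℓ r≢h with twoNeighboursOrLow r
        ... | inj₁ two = ⊥-elim (none (r , r≢ℓ , r≢h , two))
        ... | inj₂ low = low

    module AllHigh (high : ∀ z → High z) where

      -- G is not complete, for then all n vertices would be twins.
      missingEdge : ∃₂ λ a b → a ≢ b × ¬ Adj a b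
      missingEdge with any? (λ a → any? (λ b → ¬? (a ≟ b) ×-dec ¬? (adj? a b)))
      ... | yes found = found
      ... | no none = ⊥-elim (noTwinClass-n-1 zero (allBut1 (twinClass zero) zero λ v _ → ∈twinClass (twin zero v)))
        where
        adjacent : ∀ {a b} → a ≢ b → Adj a b
        adjacent {a} {b} a≢b = decidable-stable (adj? a b) λ ¬ab → none (a , b , a≢b , ¬ab)
        twin : ∀ u v → Twin G u v
        twin u v z z≢u z≢v = mk⇔ (λ _ → adjacent (z≢v ∘ sym)) (λ _ → adjacent (z≢u ∘ sym))

      -- Two missing edges ab and cd with c ∉ {a, b} are impossible: then d ∉ {a, b} too,
      -- and for x ∉ {a, b, c, d} the class {a, c, x} is separated by b and d.
      noDisjointMissingEdges : ∀ {a b c d} → a ≢ b → ¬ Adj a b → c ≢ a → c ≢ b → c ≢ d → ¬ Adj c d → ⊥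
      noDisjointMissingEdges {a} {b} {c} {d} a≢b ¬ab c≢a c≢b c≢d ¬cd with avoid a b c d
      ... | x , x≢a , x≢b , x≢c , x≢d = noPartition-n-2 (mergeTriple G conn
              (c≢a ∘ sym) (x≢a ∘ sym) (x≢c ∘ sym) (a≢b ∘ sym) (c≢b ∘ sym) (x≢b ∘ sym) d≢a (c≢d ∘ sym) (x≢d ∘ sym)
              (inj₂ (¬ab , high-adjacent (high c) (c≢d ∘ sym) (c≢b ∘ sym) ¬cd (b≢d ∘ sym)))
              (inj₂ (¬ab , adj-sym (high-adjacent (high b) a≢b (x≢b) (¬ab ∘ adj-sym) (x≢a ∘ sym))))
              (inj₂ (¬cd , adj-sym (high-adjacent (high d) (c≢d) (x≢d) (¬cd ∘ adj-sym) (x≢c ∘ sym)))))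
        where
        d≢a : d ≢ a
        d≢a refl = c≢b (sym (high d b c (a≢b ∘ sym) c≢a ¬ab (¬cd ∘ adj-sym)))
        b≢d : b ≢ d
        b≢d refl = c≢a (sym (high b a c a≢b c≢b (¬ab ∘ adj-sym) (¬cd ∘ adj-sym)))

      -- Hence, with ab a missing edge, every vertex outside {a, b} is adjacent to all others:
      -- these vertices are twins, and a missing edge inside W must be ab, which a third
      -- member of W (there are τ = n - 2 ≥ 3) rules out.
      result : τ ≡ m × CompleteOn G W
      result with missingEdge
      ... | a , b , a≢b , ¬ab = τ≡m , clique noMissingEdge
        where
        universal : ∀ {c d} → c ≢ a → c ≢ b → c ≢ d → Adj c d
        universal {c} {d} c≢a c≢b c≢d = decidable-stable (adj? c d) (noDisjointMissingEdges a≢b ¬ab c≢a c≢b c≢d)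
        u₀ = proj₁ (avoid a b a b)
        u₀≢a = proj₁ (proj₂ (avoid a b a b))
        u₀≢b = proj₁ (proj₂ (proj₂ (avoid a b a b)))
        twinOfu₀ : ∀ v → v ≢ a → v ≢ b → Twin G u₀ v
        twinOfu₀ v v≢a v≢b z z≢u₀ z≢v = mk⇔ (λ _ → universal v≢a v≢b (z≢v ∘ sym)) (λ _ → universal u₀≢a u₀≢b (z≢u₀ ∘ sym))
        τ≡m : τ ≡ m
        τ≡m = twinClass-n-2⇒τ≡m u₀ (allBut2 (twinClass u₀) a b λ v v≢a v≢b → ∈twinClass (twinOfu₀ v v≢a v≢b))
        inMissingEdge : ∀ {s t} → s ≢ t → ¬ Adj s t → s ≡ a ⊎ s ≡ b
        inMissingEdge {s} s≢t ¬st with s ≟ a | s ≟ b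
        ... | yes s≡a | _ = inj₁ s≡a
        ... | no _ | yes s≡b = inj₂ s≡b
        ... | no s≢a | no s≢b = ⊥-elim (¬st (universal s≢a s≢b s≢t))
        avoidsEdge : ∀ {s t w} → s ≢ t → ¬ Adj s t → w ≢ s → w ≢ t → w ≢ a × w ≢ b
        avoidsEdge s≢t ¬st w≢s w≢t with inMissingEdge s≢t ¬st | inMissingEdge (s≢t ∘ sym) (¬st ∘ adj-sym)
        ... | inj₁ refl | inj₁ refl = ⊥-elim (s≢t refl)
        ... | inj₁ refl | inj₂ refl = w≢s , w≢t
        ... | inj₂ refl | inj₁ refl = w≢t , w≢s
        ... | inj₂ refl | inj₂ refl = ⊥-elim (s≢t refl)
        noMissingEdge : ∀ {s t} → s ∈ W → t ∈ W → s ≢ t → ¬ Adj s t → ⊥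
        noMissingEdge {s} {t} s∈W t∈W s≢t ¬st with any? (λ w → (w ∈? W) ×-dec ¬? (w ≟ s) ×-dec ¬? (w ≟ t))
        ... | yes (w , w∈W , w≢s , w≢t) with avoidsEdge s≢t ¬st w≢s w≢t
        ...   | w≢a , w≢b = ¬st (Equivalence.from (W-twins s w s∈W w∈W t (s≢t ∘ sym) (w≢t ∘ sym)) (universal w≢a w≢b w≢t))
        noMissingEdge {s} {t} s∈W t∈W s≢t ¬st | no onlyTwo =
          ℕP.n≮n 2 (ℕP.≤-trans 3≤m (subst (_≤ 2) (trans ∣W∣≡τ τ≡m) (within2 W s t members)))
          where
          members : ∀ v → v ∈ W → v ≡ s ⊎ v ≡ t
          members v v∈W with v ≟ s | v ≟ t
          ... | yes v≡s | _ = inj₁ v≡s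
          ... | no _ | yes v≡t = inj₂ v≡t
          ... | no v≢s | no v≢t = ⊥-elim (onlyTwo (v , v∈W , v≢s , v≢t))

    result : τ ≡ m × CompleteOn G W
    result with any? low?
    ... | yes (ℓ , ℓ-low) = LowVertex.result ℓ (proj₁ (neighbour ℓ)) ℓ-low (proj₂ (neighbour ℓ))
    ... | no noLow = AllHigh.result allHigh
      where
      allHigh : ∀ z → High z
      allHigh z with lowOrHigh z
      ... | inj₁ low = ⊥-elim (noLow (z , low))
      ... | inj₂ high = high

  theorem : PartitionDimension G (suc m) ⇔ (τ ≡ suc m ⊎ (τ ≡ m × CompleteOn G W))
  theorem = mk⇔ forward backward
    where
    forward : PartitionDimension G (suc m) → τ ≡ suc m ⊎ (τ ≡ m × CompleteOn G W)
    forward ((Π , loc) , minimal) with τ ℕP.≟ suc m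
    ... | yes τ≡n-1 = inj₁ τ≡n-1
    ... | no τ≢n-1 = inj₂ (Forward.result minimal (ℕP.≤-pred (ℕP.≤∧≢⇒< (τ≤classes Π loc) τ≢n-1)))
    backward : τ ≡ suc m ⊎ (τ ≡ m × CompleteOn G W) → PartitionDimension G (suc m)
    backward (inj₁ τ≡n-1) = partition-n-1 (ℕP.≤-reflexive τ≡n-1) , λ k Π loc → subst (_≤ k) τ≡n-1 (τ≤classes Π loc)
    backward (inj₂ (τ≡m , W-clique)) = partition-n-1 (subst (_≤ suc m) (sym τ≡m) (ℕP.n≤1+n m)) , atLeast
      where
      atLeast : ∀ k (Π : Partition G k) → Locating G Π → suc m ≤ k
      atLeast k Π loc with k ℕP.≟ m
      ... | yes refl = ⊥-elim (clique⇒noPartition-n-2 W-clique τ≡m (Π , loc))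
      ... | no k≢m = ℕP.≤∧≢⇒< (subst (_≤ k) τ≡m (τ≤classes Π loc)) (k≢m ∘ sym)

mainTheorem13 : (n : ℕ) → 9 ≤ n → (G : Graph n) → Connected G →
    (τ : ℕ) → TwinNumber G τ → (W : Subset n) → TauSet G τ W →
    (PartitionDimension G (n ∸ 1) ⇔ (τ ≡ n ∸ 1 ⊎ (τ ≡ n ∸ 2 × CompleteOn G W)))
mainTheorem13 (suc (suc m)) (s≤s (s≤s 7≤m)) =
  AtLeastFiveVertices.theorem (ℕP.≤-trans (s≤s (s≤s (s≤s z≤n))) 7≤m)
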